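{- Let $\mathbb{F}$ be a finite field. Then there exists a permutation tensor $T:[n]^3\to\mathbb{F}$ with $\operatorname{rank}_{\mathbb{F}}(T)\ge\Omega(n\log_{|\mathbb{F}|}n)$; that is, there is a constant $c>0$ such that for all sufficiently large $n$ there is a permutation tensor $T_n:[n]^3\to\mathbb{F}$ with $\operatorname{rank}_{\mathbb{F}}(T_n)\ge c\, n\log_{|\mathbb{F}|}n$.
   Context: $[n]=\{1,\ldots,n\}$. A tensor $T:[n]^d\to\mathbb{F}$ is a permutation tensor if it takes only values $0,1$ and each generalized row (the $n$ inputs obtained by fixing $d-1$ coordinates and varying the remaining one) contains exactly one $1$. A tensor is simple if $T(i_1,\ldots,i_d)=\prod_j\vec v_j(i_j)$ for vectors $\vec v_j\in\mathbb{F}^n$; rank is the minimum number of simple tensors summing to $T$. -}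

module Defs where

open import Level using (Level; _⊔_; suc)
open import Data.Nat using (ℕ; zero) renaming (suc to sucℕ)
open import Data.Fin using (Fin) renaming (zero to fzero; suc to fsuc)
open import Data.Product using (Σ; ∃; _×_; _,_)
open import Data.Sum using (_⊎_)
open import Relation.Nullary using (¬_)
open import Relation.Binary.PropositionalEquality using (_≡_)
import Relation.Binary.PropositionalEquality as ≡
open import Algebra.Bundles using (CommutativeRing)
open import Function.Bundles using (Inverse)

record FiniteField (c ℓ : Level) : Set (suc (c ⊔ ℓ)) where
  field
    commRing : CommutativeRing c ℓ
  open CommutativeRing commRing public
  field
    1≉0     : ¬ (1# ≈ 0#)
    inverse : ∀ x → ¬ (x ≈ 0#) → Σ Carrier (λ y → (x * y) ≈ 1#)
    size    : ℕ
    enum    : Inverse setoid (≡.setoid (Fin size))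

module _ {c ℓ : Level} (F : FiniteField c ℓ) where
  open FiniteField F

  -- 3-tensors [n]^3 → F  (indices 0..n-1 stand for [n] = {1..n})
  Tensor3 : ℕ → Set c
  Tensor3 n = Fin n → Fin n → Fin n → Carrier

  IsPermutationTensor : ∀ {n} → Tensor3 n → Set ℓ
  IsPermutationTensor {n} T =
      (∀ i j k → (T i j k ≈ 0#) ⊎ (T i j k ≈ 1#))
    × (∀ j k → Σ (Fin n) λ i → (T i j k ≈ 1#) × (∀ i′ → T i′ j k ≈ 1# → i′ ≡ i))
    × (∀ i k → Σ (Fin n) λ j → (T i j k ≈ 1#) × (∀ j′ → T i j′ k ≈ 1# → j′ ≡ j))
    × (∀ i j → Σ (Fin n) λ k → (T i j k ≈ 1#) × (∀ k′ → T i j k′ ≈ 1# → k′ ≡ k))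

  sumFin : ∀ r → (Fin r → Carrier) → Carrier
  sumFin zero     f = 0#
  sumFin (sucℕ r) f = f fzero + sumFin r (λ t → f (fsuc t))

  -- T is a sum of r simple tensors  u_t ⊗ v_t ⊗ w_t  (t < r),
  -- i.e. rank_F(T) ≤ r.
  HasRankDecomposition : ∀ {n} → Tensor3 n → ℕ → Set (c ⊔ ℓ)
  HasRankDecomposition {n} T r =
    Σ (Fin r → Fin n → Carrier) λ u →
    Σ (Fin r → Fin n → Carrier) λ v →
    Σ (Fin r → Fin n → Carrier) λ w →
      ∀ i j k → T i j k ≈ sumFin r (λ t → u t i * v t j * w t k)

-- A Latin square L of order n gives the permutation tensor T(i,j,k) = [L(i,j) = k].  Adding a row
-- to a Latin r × n rectangle amounts to a perfect matching in the (n − r)-regular bipartite graph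
-- joining each column to the symbols it does not yet contain, and by M. Hall's theorem there are at
-- least (n − r)! of them; hence there are at least ∏_{r<n} (n − r)! = n^Ω(n²) Latin squares.  A tensor
-- of rank at most R is given by 3R factor vectors in F^n, so there are at most q^(3Rn) of them (q = |F|).
-- Taking R largest with q^(75R) < n^n, the Latin squares outnumber the tensors of rank at most R, so
-- some permutation tensor has rank r > R, that is q^(75r) ≥ n^n, i.e. rank ≥ (1/75) n log_q n.

module Submission where

open import Defs
open import Level using (Level; _⊔_)
open import Data.Nat
  using (ℕ; zero; suc; _+_; _*_; _∸_; _^_; _!; _/_; _%_; _≤_; _<_; _≥_; z≤n; s≤s; _≟_; _≤?_; _<?_; NonZero; >-nonZero)
open import Data.Nat.Base using (_≤′_; ≤′-refl; ≤′-step)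
open import Data.Nat.Properties hiding (_≟_)
open import Data.Nat.DivMod using (m/n*n≤m; m≡m%n+[m/n]*n; m%n<n; /-monoˡ-≤)
open import Data.Nat.Tactic.RingSolver using (solve-∀)
open import Algebra.Properties.Semiring.Sum +-*-semiring
  using (sum; sum-cong-≗; sum-replicate-zero; ∑-distrib-+; ∑-comm; *-distribʳ-sum)
open import Data.Bool using (Bool; true; false; _∧_; _∨_; not; if_then_else_)
import Data.Bool.Properties as Bool
open import Data.Fin using (Fin; zero; suc; combine; remQuot; finToFun; funToFin)
import Data.Fin.Properties as Fin
import Data.Fin.Subset.Properties as Subset
open import Data.Vec using (lookup; tabulate)
open import Data.Vec.Properties using (lookup∘tabulate)
open import Data.Product using (Σ; ∃; ∃₂; _×_; _,_; proj₁; proj₂; uncurry)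
open import Data.Sum using (_⊎_; inj₁; inj₂)
open import Data.Empty using (⊥-elim)
open import Function using (_∘_; _∘′_; case_of_)
open import Function.Bundles using (Inverse; Injection)
open import Function.Definitions using (Injective)
open import Function.Properties.Inverse using (Inverse⇒Injection)
open import Relation.Nullary using (¬_; Dec; yes; no)
open import Relation.Nullary.Decidable using (⌊_⌋; ¬?; decidable-stable; _×-dec_; _→-dec_; map′)
open import Relation.Unary using (Decidable)
open import Relation.Binary.PropositionalEquality

-- Finite sets as Boolean predicates

FinSet : ℕ → Set
FinSet n = Fin n → Bool

private
  variable
    n r : ℕ

χ : Bool → ℕ
χ true  = 1
χ false = 0

module _ {n : ℕ} where

  infix  4 _∈_ _∉_ _⊆_
  infixr 7 _∩_
  infixr 6 _∪_ _∖_
  infixl 8 _─_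

  _∈_ _∉_ : Fin n → FinSet n → Set
  x ∈ A = A x ≡ true
  x ∉ A = ¬ x ∈ A

  _⊆_ : FinSet n → FinSet n → Set
  A ⊆ B = ∀ x → x ∈ A → x ∈ B

  ∅ full : FinSet n
  ∅    _ = false
  full _ = true

  ⁅_⁆ : Fin n → FinSet n
  ⁅ x ⁆ y = ⌊ y Fin.≟ x ⌋

  _∩_ _∪_ _∖_ : FinSet n → FinSet n → FinSet n
  (A ∩ B) x = A x ∧ B x
  (A ∪ B) x = A x ∨ B x
  (A ∖ B) x = A x ∧ not (B x)

  ∁ : FinSet n → FinSet n
  ∁ A = not ∘ A

  _─_ : FinSet n → Fin n → FinSet n
  A ─ x = A ∖ ⁅ x ⁆

  card : FinSet n → ℕ
  card A = sum (χ ∘ A)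

  ∈-∩⁺ : ∀ A B {x} → x ∈ A → x ∈ B → x ∈ A ∩ B
  ∈-∩⁺ A B x∈A x∈B rewrite x∈A | x∈B = refl

  ∈-∩⁻ : ∀ A B {x} → x ∈ A ∩ B → x ∈ A × x ∈ B
  ∈-∩⁻ A B {x} x∈A∩B with A x | B x
  ... | true | true = refl , refl

  ∈-∪⁺ˡ : ∀ A B {x} → x ∈ A → x ∈ A ∪ B
  ∈-∪⁺ˡ A B x∈A rewrite x∈A = refl

  ∈-∪⁺ʳ : ∀ A B {x} → x ∈ B → x ∈ A ∪ B
  ∈-∪⁺ʳ A B {x} x∈B with A x
  ... | true  = refl
  ... | false = x∈B

  ∈-∪⁻ : ∀ A B {x} → x ∈ A ∪ B → x ∈ A ⊎ x ∈ B
  ∈-∪⁻ A B {x} x∈A∪B with A x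
  ... | true  = inj₁ refl
  ... | false = inj₂ x∈A∪B

  ∈-∖⁺ : ∀ A B {x} → x ∈ A → x ∉ B → x ∈ A ∖ B
  ∈-∖⁺ A B {x} x∈A x∉B rewrite x∈A with B x
  ... | true  = ⊥-elim (x∉B refl)
  ... | false = refl

  ∈-∖⁻ : ∀ A B {x} → x ∈ A ∖ B → x ∈ A × x ∉ B
  ∈-∖⁻ A B {x} x∈A∖B with A x | B x
  ... | true | false = refl , λ ()

  ∈-∁⁻ : ∀ A {x} → x ∈ ∁ A → x ∉ A
  ∈-∁⁻ A x∈∁A x∈A = case trans (sym x∈∁A) (cong not x∈A) of λ ()

  x∈⁅x⁆ : ∀ x → x ∈ ⁅ x ⁆
  x∈⁅x⁆ x with x Fin.≟ x
  ... | yes _  = refl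
  ... | no x≢x = ⊥-elim (x≢x refl)

  ∈-⁅⁆⁻ : ∀ {x y} → y ∈ ⁅ x ⁆ → y ≡ x
  ∈-⁅⁆⁻ {x} {y} y∈⁅x⁆ with y Fin.≟ x
  ... | yes y≡x = y≡x

  infix 4 _∈?_
  _∈?_ : ∀ x A → Dec (x ∈ A)
  x ∈? A = A x Bool.≟ true

  ∈-─⁺ : ∀ A {x y} → y ∈ A → y ≢ x → y ∈ A ─ x
  ∈-─⁺ A {x} y∈A y≢x = ∈-∖⁺ A ⁅ x ⁆ y∈A (y≢x ∘ ∈-⁅⁆⁻)

  ∈-─⁻ : ∀ A {x y} → y ∈ A ─ x → y ∈ A × y ≢ x
  ∈-─⁻ A {x} y∈A─x with ∈-∖⁻ A ⁅ x ⁆ y∈A─x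
  ... | y∈A , y∉⁅x⁆ = y∈A , λ { refl → y∉⁅x⁆ (x∈⁅x⁆ x) }

sum-mono-≤ : {f g : Fin n → ℕ} → (∀ i → f i ≤ g i) → sum f ≤ sum g
sum-mono-≤ {zero}  f≤g = z≤n
sum-mono-≤ {suc n} f≤g = +-mono-≤ (f≤g zero) (sum-mono-≤ (f≤g ∘ suc))

sum-mono-< : {f g : Fin n → ℕ} → (∀ i → f i ≤ g i) → ∀ i → f i < g i → sum f < sum g
sum-mono-< f≤g zero    fi<gi = +-mono-<-≤ fi<gi (sum-mono-≤ (f≤g ∘ suc))
sum-mono-< f≤g (suc i) fi<gi = +-mono-≤-< (f≤g zero) (sum-mono-< (f≤g ∘ suc) i fi<gi)

card-cong : {A B : FinSet n} → (∀ x → A x ≡ B x) → card A ≡ card B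
card-cong A≗B = sum-cong-≗ (cong χ ∘ A≗B)

card-∅ : card {n} ∅ ≡ 0
card-∅ {n} = sum-replicate-zero n

card-full : card {n} full ≡ n
card-full {zero}  = refl
card-full {suc n} = cong suc card-full

χ-mono : ∀ {a b} → (a ≡ true → b ≡ true) → χ a ≤ χ b
χ-mono {true}  a⇒b rewrite a⇒b refl = ≤-refl
χ-mono {false} a⇒b = z≤n

card-mono : {A B : FinSet n} → A ⊆ B → card A ≤ card B
card-mono A⊆B = sum-mono-≤ (λ x → χ-mono (A⊆B x))

card-mono-< : {A B : FinSet n} → A ⊆ B → ∀ x → x ∉ A → x ∈ B → card A < card B
card-mono-< {A = A} A⊆B x x∉A x∈B = sum-mono-< (λ y → χ-mono (A⊆B y)) x (χ<χ x∉A x∈B)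
  where
  χ<χ : ∀ {a b} → a ≢ true → b ≡ true → χ a < χ b
  χ<χ {true}  a≢true = ⊥-elim (a≢true refl)
  χ<χ {false} a≢true refl = s≤s z≤n

card≤n : (A : FinSet n) → card A ≤ n
card≤n {n} A = ≤-trans (card-mono {B = full {n}} (λ _ _ → refl)) (≤-reflexive (card-full {n}))

card-∪-∩ : (A B : FinSet n) → card (A ∪ B) + card (A ∩ B) ≡ card A + card B
card-∪-∩ A B = begin
  card (A ∪ B) + card (A ∩ B)         ≡⟨ ∑-distrib-+ (χ ∘ (A ∪ B)) (χ ∘ (A ∩ B)) ⟨
  sum (λ x → χ (A x ∨ B x) + χ (A x ∧ B x)) ≡⟨ sum-cong-≗ (λ x → pointwise (A x) (B x)) ⟩
  sum (λ x → χ (A x) + χ (B x))        ≡⟨ ∑-distrib-+ (χ ∘ A) (χ ∘ B) ⟩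
  card A + card B                      ∎
  where
  open ≡-Reasoning
  pointwise : ∀ a b → χ (a ∨ b) + χ (a ∧ b) ≡ χ a + χ b
  pointwise true  true  = refl
  pointwise true  false = refl
  pointwise false b     = +-identityʳ (χ b)

card-∪-≤ : (A B : FinSet n) → card (A ∪ B) ≤ card A + card B
card-∪-≤ A B = ≤-trans (m≤m+n _ (card (A ∩ B))) (≤-reflexive (card-∪-∩ A B))

card-∪-disjoint : (A B : FinSet n) → (∀ x → x ∈ A → x ∉ B) → card (A ∪ B) ≡ card A + card B
card-∪-disjoint {n} A B disjoint = begin
  card (A ∪ B)                ≡⟨ +-identityʳ _ ⟨
  card (A ∪ B) + 0            ≡⟨ cong (card (A ∪ B) +_) (trans (card-cong A∩B≗∅) (card-∅ {n})) ⟨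
  card (A ∪ B) + card (A ∩ B) ≡⟨ card-∪-∩ A B ⟩
  card A + card B             ∎
  where
  open ≡-Reasoning
  A∩B≗∅ : ∀ x → (A ∩ B) x ≡ false
  A∩B≗∅ x with A x in x∈A | B x in x∈B
  ... | false | _     = refl
  ... | true  | false = refl
  ... | true  | true  = ⊥-elim (disjoint x x∈A x∈B)

card-∁ : (A : FinSet n) → card (∁ A) + card A ≡ n
card-∁ {n} A = begin
  card (∁ A) + card A           ≡⟨ ∑-distrib-+ (χ ∘ ∁ A) (χ ∘ A) ⟨
  sum (λ x → χ (not (A x)) + χ (A x)) ≡⟨ sum-cong-≗ (λ x → pointwise (A x)) ⟩
  card {n} full                 ≡⟨ card-full ⟩
  _                             ∎
  where
  open ≡-Reasoning
  pointwise : ∀ a → χ (not a) + χ a ≡ 1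
  pointwise true  = refl
  pointwise false = refl

card-⁅⁆ : (x : Fin n) → card ⁅ x ⁆ ≡ 1
card-⁅⁆ {suc n} zero    = cong suc (card-∅ {n})
card-⁅⁆ {suc n} (suc x) = trans (card-cong ⁅suc⁆) (card-⁅⁆ x)
  where
  ⁅suc⁆ : ∀ y → ⁅ suc x ⁆ (suc y) ≡ ⁅ x ⁆ y
  ⁅suc⁆ y with y Fin.≟ x
  ... | yes _ = refl
  ... | no  _ = refl

card≤1+card-─ : (A : FinSet n) → ∀ x → card A ≤ suc (card (A ─ x))
card≤1+card-─ A x = begin
  card A                    ≤⟨ card-mono A⊆A─x∪⁅x⁆ ⟩
  card (A ─ x ∪ ⁅ x ⁆)      ≤⟨ card-∪-≤ (A ─ x) ⁅ x ⁆ ⟩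
  card (A ─ x) + card ⁅ x ⁆ ≡⟨ cong (card (A ─ x) +_) (card-⁅⁆ x) ⟩
  card (A ─ x) + 1          ≡⟨ +-comm _ 1 ⟩
  suc (card (A ─ x))        ∎
  where
  open ≤-Reasoning
  A⊆A─x∪⁅x⁆ : A ⊆ A ─ x ∪ ⁅ x ⁆
  A⊆A─x∪⁅x⁆ y y∈A = split (y Fin.≟ x)
    where
    split : Dec (y ≡ x) → y ∈ A ─ x ∪ ⁅ x ⁆
    split (yes refl) = ∈-∪⁺ʳ (A ─ x) ⁅ x ⁆ (x∈⁅x⁆ x)
    split (no  y≢x)  = ∈-∪⁺ˡ (A ─ x) ⁅ x ⁆ (∈-─⁺ A y∈A y≢x)

card-─ : (A : FinSet n) → ∀ {x} → x ∈ A → card A ≡ suc (card (A ─ x))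
card-─ A {x} x∈A = ≤-antisym (card≤1+card-─ A x)
  (card-mono-< (λ y → proj₁ ∘ ∈-─⁻ A) x (λ x∈A─x → proj₂ (∈-─⁻ A x∈A─x) refl) x∈A)

nonempty : (A : FinSet n) → 0 < card A → ∃ (_∈ A)
nonempty {suc n} A 0<card with A zero in zero∈A
... | true  = zero , zero∈A
... | false with nonempty (A ∘ suc) 0<card
...   | x , x∈A = suc x , x∈A

card≡0⇒∉ : (A : FinSet n) → card A ≡ 0 → ∀ x → x ∉ A
card≡0⇒∉ {n} A card≡0 x x∈A =
  <⇒≢ (card-mono-< {A = ∅} (λ _ ()) x (λ ()) x∈A) (trans (card-∅ {n}) (sym card≡0))

choose : (A : FinSet n) → ∀ k → k ≤ card A →
         Σ (Fin k → Fin n) λ g → Injective _≡_ _≡_ g × (∀ i → g i ∈ A)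
choose         A zero    _ = (λ ()) , (λ { {()} }) , (λ ())
choose {suc n} A (suc k) k<card with A zero in zero∈A
... | true with choose (A ∘ suc) k (≤-pred k<card)
...   | g , g-inj , g∈A = g′ , g′-inj , g′∈A
  where
  g′ : Fin (suc k) → Fin (suc n)
  g′ zero    = zero
  g′ (suc i) = suc (g i)
  g′-inj : Injective _≡_ _≡_ g′
  g′-inj {zero}  {zero}  _  = refl
  g′-inj {suc i} {suc j} eq = cong suc (g-inj (Fin.suc-injective eq))
  g′∈A : ∀ i → g′ i ∈ A
  g′∈A zero    = zero∈A
  g′∈A (suc i) = g∈A i
choose {suc n} A (suc k) k<card | false with choose (A ∘ suc) (suc k) k<card
... | g , g-inj , g∈A = suc ∘ g , g-inj ∘ Fin.suc-injective , g∈A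

image : (Fin r → Fin n) → FinSet n
image {r = zero}  g = ∅
image {r = suc r} g = ⁅ g zero ⁆ ∪ image (g ∘ suc)

∈-image⁺ : (g : Fin r → Fin n) → ∀ i → g i ∈ image g
∈-image⁺ g zero    = ∈-∪⁺ˡ ⁅ g zero ⁆ (image (g ∘ suc)) (x∈⁅x⁆ (g zero))
∈-image⁺ g (suc i) = ∈-∪⁺ʳ ⁅ g zero ⁆ (image (g ∘ suc)) (∈-image⁺ (g ∘ suc) i)

∈-image⁻ : (g : Fin r → Fin n) → ∀ {y} → y ∈ image g → ∃ λ i → g i ≡ y
∈-image⁻ {r = suc r} g y∈image with ∈-∪⁻ ⁅ g zero ⁆ (image (g ∘ suc)) y∈image
... | inj₁ y∈⁅g0⁆ = zero , sym (∈-⁅⁆⁻ y∈⁅g0⁆)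
... | inj₂ y∈rest with ∈-image⁻ (g ∘ suc) y∈rest
...   | i , gi≡y = suc i , gi≡y

card-image : (g : Fin r → Fin n) → Injective _≡_ _≡_ g → card (image g) ≡ r
card-image {r = zero} {n} g g-inj = card-∅ {n}
card-image {r = suc r} g g-inj = begin
  card (image g)                            ≡⟨ card-∪-disjoint ⁅ g zero ⁆ (image (g ∘ suc)) new ⟩
  card ⁅ g zero ⁆ + card (image (g ∘ suc))  ≡⟨ cong₂ _+_ (card-⁅⁆ (g zero))
                                                         (card-image (g ∘ suc) (Fin.suc-injective ∘ g-inj)) ⟩
  suc r                                     ∎
  where
  open ≡-Reasoning
  new : ∀ y → y ∈ ⁅ g zero ⁆ → y ∉ image (g ∘ suc)
  new y y∈⁅g0⁆ y∈rest with ∈-image⁻ (g ∘ suc) y∈rest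
  ... | i , gi≡y with g-inj (trans gi≡y (∈-⁅⁆⁻ y∈⁅g0⁆))
  ...   | ()

any : (Fin n → Bool) → Bool
any {zero}  f = false
any {suc n} f = f zero ∨ any (f ∘ suc)

any⁺ : (f : Fin n → Bool) → ∀ x → f x ≡ true → any f ≡ true
any⁺ f zero    fx = cong (_∨ any (f ∘ suc)) fx
any⁺ f (suc x) fx with f zero
... | true  = refl
... | false = any⁺ (f ∘ suc) x fx

any⁻ : (f : Fin n → Bool) → any f ≡ true → ∃ λ x → f x ≡ true
any⁻ {suc n} f any≡true with f zero in f0
... | true  = zero , f0
... | false with any⁻ (f ∘ suc) any≡true
...   | x , fx = suc x , fx

any-cong : {f g : Fin n → Bool} → (∀ x → f x ≡ g x) → any f ≡ any g
any-cong {zero}  f≗g = refl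
any-cong {suc n} f≗g = cong₂ _∨_ (f≗g zero) (any-cong (f≗g ∘ suc))

injective⇒surjective : (g : Fin n → Fin n) → Injective _≡_ _≡_ g → ∀ y → ∃ λ x → g x ≡ y
injective⇒surjective {n} g g-inj y with y ∈? image g
... | yes y∈image = ∈-image⁻ g y∈image
... | no  y∉image = ⊥-elim (<⇒≢ (begin-strict
  card (image g) <⟨ card-mono-< {B = full} (λ _ _ → refl) y y∉image refl ⟩
  card {n} full  ≡⟨ card-full ⟩
  n              ∎) (card-image g g-inj))
  where open ≤-Reasoning

-- Families of pairwise apart elements

module _ {a ℓ} {A : Set a} (_#_ : A → A → Set ℓ) where

  ApartFamily : ℕ → Set (a ⊔ ℓ)
  ApartFamily m = Σ (Fin m → A) λ f → ∀ {i j} → i ≢ j → f i # f j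

  apartFamily-* : ∀ {k m} (f : Fin k → Fin m → A) →
                  (∀ i {j j′} → j ≢ j′ → f i j # f i j′) →
                  (∀ {i i′} j j′ → i ≢ i′ → f i j # f i′ j′) →
                  ApartFamily (k * m)
  apartFamily-* {k} {m} f inner outer = uncurry f ∘ remQuot m , λ l≢l′ → apart _ _ (l≢l′ ∘ remQuot-injective)
    where
    remQuot-injective : ∀ {l l′} → remQuot {k} m l ≡ remQuot m l′ → l ≡ l′
    remQuot-injective {l} {l′} eq =
      trans (sym (Fin.combine-remQuot {k} m l)) (trans (cong (uncurry combine) eq) (Fin.combine-remQuot {k} m l′))
    apart : ∀ p p′ → p ≢ p′ → uncurry f p # uncurry f p′
    apart (i , j) (i′ , j′) p≢p′ with i Fin.≟ i′ | j Fin.≟ j′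
    ... | no i≢i′  | _        = outer j j′ i≢i′
    ... | yes refl | no j≢j′  = inner i j≢j′
    ... | yes refl | yes refl = ⊥-elim (p≢p′ refl)

  -- Pigeonhole: a name can only be shared by members that are not apart.
  apartFamily-unnamed : ∀ {k m ℓ′} ((f , apart) : ApartFamily m) (names : Fin k → A → Set ℓ′) →
                   (∀ x i → Dec (names x (f i))) → (∀ x y z → names x y → names x z → ¬ y # z) →
                   k < m → ∃ λ i → ∀ x → ¬ names x (f i)
  apartFamily-unnamed {k} {m} (f , apart) names names? unique k<m
    with Fin.any? (λ i → Fin.all? (λ x → ¬? (names? x i)))
  ... | yes unnamed   = unnamed
  ... | no  all-named = ⊥-elim (<⇒≱ k<m (Fin.injective⇒≤ name-injective))
    where
    named : ∀ i → ∃ λ x → names x (f i)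
    named i with Fin.¬∀⟶∃¬ k (λ x → ¬ names x (f i)) (λ x → ¬? (names? x i)) (λ none → all-named (i , none))
    ... | x , ¬¬named = x , decidable-stable (names? x i) ¬¬named
    name-injective : Injective _≡_ _≡_ (proj₁ ∘ named)
    name-injective {i} {j} eq with i Fin.≟ j
    ... | yes i≡j = i≡j
    ... | no  i≢j = ⊥-elim (unique _ (f i) (f j) (proj₂ (named i))
                                   (subst (λ x → names x (f j)) (sym eq) (proj₂ (named j))) (apart i≢j))

-- Matchings and M. Hall's theorem

module _ {n : ℕ} {B : Set} where

  piecewise : FinSet n → (Fin n → B) → (Fin n → B) → Fin n → B
  piecewise A f g x = if A x then f x else g x

  piecewise-∈ : ∀ A f g {x} → x ∈ A → piecewise A f g x ≡ f x
  piecewise-∈ A f g x∈A rewrite x∈A = refl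

  piecewise-∉ : ∀ A f g {x} → x ∉ A → piecewise A f g x ≡ g x
  piecewise-∉ A f g x∉A rewrite Bool.¬-not x∉A = refl

module BipartiteGraph {n : ℕ} (E : Fin n → Fin n → Bool) where

  infix 4 _~_
  _~_ : Fin n → Fin n → Set
  x ~ y = E x y ≡ true

  infix 9 N[_]_
  N[_]_ : FinSet n → FinSet n → FinSet n
  (N[ Y ] A) y = Y y ∧ any (λ x → A x ∧ E x y)

  ∈-N⁺ : ∀ Y A {x y} → y ∈ Y → x ∈ A → x ~ y → y ∈ N[ Y ] A
  ∈-N⁺ Y A {x} {y} y∈Y x∈A x~y =
    ∈-∩⁺ Y (λ y → any (λ x → A x ∧ E x y)) y∈Y
         (any⁺ (λ x → A x ∧ E x y) x (∈-∩⁺ A (λ x → E x y) x∈A x~y))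

  ∈-N⁻ : ∀ Y A {y} → y ∈ N[ Y ] A → y ∈ Y × ∃ λ x → x ∈ A × x ~ y
  ∈-N⁻ Y A {y} y∈N with ∈-∩⁻ Y (λ y → any (λ x → A x ∧ E x y)) y∈N
  ... | y∈Y , adjacent with any⁻ (λ x → A x ∧ E x y) adjacent
  ...   | x , x∈A∧x~y = y∈Y , x , ∈-∩⁻ A (λ x → E x y) x∈A∧x~y

  HallCondition : FinSet n → FinSet n → Set
  HallCondition X Y = ∀ A → A ⊆ X → card A ≤ card (N[ Y ] A)

  MinDegree : ℕ → FinSet n → FinSet n → Set
  MinDegree k X Y = ∀ x → x ∈ X → k ≤ card (Y ∩ E x)

  record Matching (X Y : FinSet n) : Set where
    field
      mate     : Fin n → Fin n
      mate-~   : ∀ {x} → x ∈ X → x ~ mate x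
      mate-∈   : ∀ {x} → x ∈ X → mate x ∈ Y
      mate-inj : ∀ {x x′} → x ∈ X → x′ ∈ X → mate x ≡ mate x′ → x ≡ x′
  open Matching public

  Distinct : ∀ {X Y} → Matching X Y → Matching X Y → Set
  Distinct {X} M M′ = ∃ λ x → x ∈ X × mate M x ≢ mate M′ x

  Matchings : ℕ → FinSet n → FinSet n → Set
  Matchings m X Y = ApartFamily (Distinct {X} {Y}) m

  Critical : FinSet n → FinSet n → FinSet n → Set
  Critical X Y A = A ⊆ X × 0 < card A × card A < card X × card (N[ Y ] A) ≤ card A

  critical? : ∀ X Y → Dec (∃ (Critical X Y))
  critical? X Y = map′ (λ (A , c) → lookup A , c)
                       (λ (A , c) → tabulate A , cong-critical (sym ∘ lookup∘tabulate A) c)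
                       (Subset.anySubset? (λ A → critical-dec (lookup A)))
    where
    critical-dec : ∀ A → Dec (Critical X Y A)
    critical-dec A = Fin.all? (λ x → x ∈? A →-dec x ∈? X)
                  ×-dec (0 <? card A) ×-dec (card A <? card X) ×-dec (card (N[ Y ] A) ≤? card A)
    cong-critical : ∀ {A B} → (∀ x → A x ≡ B x) → Critical X Y A → Critical X Y B
    cong-critical {A} {B} A≗B (A⊆X , nonempty , proper , tight) =
      (λ x → A⊆X x ∘ trans (A≗B x)) ,
      subst (0 <_) (card-cong A≗B) nonempty ,
      subst (_< card X) (card-cong A≗B) proper ,
      subst₂ _≤_ (card-cong N≗) (card-cong A≗B) tight
      where
      N≗ : ∀ y → (N[ Y ] A) y ≡ (N[ Y ] B) y
      N≗ y = cong (Y y ∧_) (any-cong (λ x → cong (_∧ E x y) (A≗B x)))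

  HallMatchings : ℕ → Set
  HallMatchings s = ∀ {X Y} k → card X ≤ s → k ≤ card X →
                    HallCondition X Y → MinDegree k X Y → Matchings (k !) X Y

  empty-matching : ∀ {X Y} → (∀ x → x ∉ X) → Matchings 1 X Y
  empty-matching X-empty =
    (λ _ → record { mate = λ x → x ; mate-~ = ⊥-elim ∘ X-empty _ ; mate-∈ = ⊥-elim ∘ X-empty _
                  ; mate-inj = λ x∈X _ _ → ⊥-elim (X-empty _ x∈X) }) ,
    λ { {zero} {zero} 0≢0 → ⊥-elim (0≢0 refl) }

  hall⇒degree≥1 : ∀ {X Y} → HallCondition X Y → MinDegree 1 X Y
  hall⇒degree≥1 {X} {Y} hall x x∈X = begin
    1                     ≡⟨ card-⁅⁆ x ⟨
    card ⁅ x ⁆            ≤⟨ hall ⁅ x ⁆ (λ y y∈⁅x⁆ → subst (_∈ X) (sym (∈-⁅⁆⁻ y∈⁅x⁆)) x∈X) ⟩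
    card (N[ Y ] ⁅ x ⁆)   ≤⟨ card-mono N⁅x⁆⊆Y∩Ex ⟩
    card (Y ∩ E x)        ∎
    where
    open ≤-Reasoning
    N⁅x⁆⊆Y∩Ex : N[ Y ] ⁅ x ⁆ ⊆ Y ∩ E x
    N⁅x⁆⊆Y∩Ex y y∈N with ∈-N⁻ Y ⁅ x ⁆ y∈N
    ... | y∈Y , x′ , x′∈⁅x⁆ , x′~y = ∈-∩⁺ Y (E x) y∈Y (subst (_~ y) (∈-⁅⁆⁻ x′∈⁅x⁆) x′~y)

  hall-─ : ∀ {X Y x} → HallCondition X Y → ¬ ∃ (Critical X Y) → x ∈ X →
           ∀ y → HallCondition (X ─ x) (Y ─ y)
  hall-─ {X} {Y} {x} hall no-critical x∈X y B B⊆X─x with card B ≟ 0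
  ... | yes card≡0 = subst (_≤ card (N[ Y ─ y ] B)) (sym card≡0) z≤n
  ... | no  card≢0 = ≤-pred (begin-strict
    card B                       <⟨ expanding ⟩
    card (N[ Y ] B)              ≤⟨ card≤1+card-─ (N[ Y ] B) y ⟩
    suc (card (N[ Y ] B ─ y))    ≤⟨ s≤s (card-mono N─y⊆) ⟩
    suc (card (N[ Y ─ y ] B))    ∎)
    where
    open ≤-Reasoning
    B⊆X : B ⊆ X
    B⊆X z = proj₁ ∘ ∈-─⁻ X ∘ B⊆X─x z
    B<X : card B < card X
    B<X = begin-strict
      card B          ≤⟨ card-mono B⊆X─x ⟩
      card (X ─ x)    <⟨ n<1+n _ ⟩
      suc (card (X ─ x)) ≡⟨ card-─ X x∈X ⟨
      card X          ∎
    expanding : card B < card (N[ Y ] B)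
    expanding = ≰⇒> (λ tight → no-critical (B , B⊆X , n≢0⇒n>0 card≢0 , B<X , tight))
    N─y⊆ : N[ Y ] B ─ y ⊆ N[ Y ─ y ] B
    N─y⊆ z z∈N─y with ∈-─⁻ (N[ Y ] B) z∈N─y
    ... | z∈N , z≢y with ∈-N⁻ Y B z∈N
    ...   | z∈Y , x′ , x′∈B , x′~z = ∈-N⁺ (Y ─ y) B (∈-─⁺ Y z∈Y z≢y) x′∈B x′~z

  degree-─ : ∀ {k X Y} x y → MinDegree (suc k) X Y → MinDegree k (X ─ x) (Y ─ y)
  degree-─ {k} {X} {Y} x y degree z z∈X─x = ≤-pred (begin
    suc k                         ≤⟨ degree z (proj₁ (∈-─⁻ X z∈X─x)) ⟩
    card (Y ∩ E z)                ≤⟨ card≤1+card-─ (Y ∩ E z) y ⟩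
    suc (card ((Y ∩ E z) ─ y))    ≤⟨ s≤s (card-mono ⊆Y─y∩Ez) ⟩
    suc (card ((Y ─ y) ∩ E z))    ∎)
    where
    open ≤-Reasoning
    ⊆Y─y∩Ez : (Y ∩ E z) ─ y ⊆ (Y ─ y) ∩ E z
    ⊆Y─y∩Ez w w∈ with ∈-─⁻ (Y ∩ E z) w∈
    ... | w∈Y∩Ez , w≢y with ∈-∩⁻ Y (E z) w∈Y∩Ez
    ...   | w∈Y , z~w = ∈-∩⁺ (Y ─ y) (E z) (∈-─⁺ Y w∈Y w≢y) z~w

  insert : ∀ {X Y x y} → x ~ y → y ∈ Y → Matching (X ─ x) (Y ─ y) → Matching X Y
  insert {X} {Y} {x} {y} x~y y∈Y M = record
    { mate     = mate′
    ; mate-~   = λ {z} → mate′-~ (z Fin.≟ x)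
    ; mate-∈   = λ {z} → mate′-∈ (z Fin.≟ x)
    ; mate-inj = λ {z} {z′} → mate′-inj (z Fin.≟ x) (z′ Fin.≟ x)
    }
    where
    mate′ = piecewise ⁅ x ⁆ (λ _ → y) (mate M)
    ∈X─x : ∀ {z} → z ∈ X → z ≢ x → z ∈ X ─ x
    ∈X─x = ∈-─⁺ X
    mate′-x : mate′ x ≡ y
    mate′-x = piecewise-∈ ⁅ x ⁆ (λ _ → y) (mate M) (x∈⁅x⁆ x)
    mate′-z : ∀ {z} → z ≢ x → mate′ z ≡ mate M z
    mate′-z z≢x = piecewise-∉ ⁅ x ⁆ (λ _ → y) (mate M) (z≢x ∘ ∈-⁅⁆⁻)
    mate′-~ : ∀ {z} → Dec (z ≡ x) → z ∈ X → z ~ mate′ z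
    mate′-~ (yes refl) _   = subst (x ~_) (sym mate′-x) x~y
    mate′-~ (no z≢x)   z∈X = subst (_ ~_) (sym (mate′-z z≢x)) (mate-~ M (∈X─x z∈X z≢x))
    mate′-∈ : ∀ {z} → Dec (z ≡ x) → z ∈ X → mate′ z ∈ Y
    mate′-∈ (yes refl) _   = subst (_∈ Y) (sym mate′-x) y∈Y
    mate′-∈ (no z≢x)   z∈X = subst (_∈ Y) (sym (mate′-z z≢x)) (proj₁ (∈-─⁻ Y (mate-∈ M (∈X─x z∈X z≢x))))
    y∉M : ∀ {z} → z ≢ x → z ∈ X → y ≢ mate′ z
    y∉M z≢x z∈X y≡ = proj₂ (∈-─⁻ Y (mate-∈ M (∈X─x z∈X z≢x))) (trans (sym (mate′-z z≢x)) (sym y≡))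
    mate′-inj : ∀ {z z′} → Dec (z ≡ x) → Dec (z′ ≡ x) → z ∈ X → z′ ∈ X →
                mate′ z ≡ mate′ z′ → z ≡ z′
    mate′-inj (yes refl) (yes refl) _   _    _  = refl
    mate′-inj (yes refl) (no z′≢x)  _   z′∈X eq = ⊥-elim (y∉M z′≢x z′∈X (trans (sym mate′-x) eq))
    mate′-inj (no z≢x)   (yes refl) z∈X _    eq = ⊥-elim (y∉M z≢x z∈X (trans (sym mate′-x) (sym eq)))
    mate′-inj (no z≢x)   (no z′≢x)  z∈X z′∈X eq = mate-inj M (∈X─x z∈X z≢x) (∈X─x z′∈X z′≢x)
      (trans (sym (mate′-z z≢x)) (trans eq (mate′-z z′≢x)))

  matchings-by-removal : ∀ {s X Y} k → HallMatchings s → card X ≤ suc s → suc k ≤ card X →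
                         HallCondition X Y → MinDegree (suc k) X Y → ¬ ∃ (Critical X Y) →
                         Matchings (suc k !) X Y
  matchings-by-removal {s} {X} {Y} k IH X≤1+s k<X hall degree no-critical = apartFamily-* Distinct M inner outer
    where
    x   = proj₁ (nonempty X (≤-trans (s≤s z≤n) k<X))
    x∈X = proj₂ (nonempty X (≤-trans (s≤s z≤n) k<X))
    neighbours = choose (Y ∩ E x) (suc k) (degree x x∈X)
    neighbour = proj₁ neighbours
    neighbour-inj = proj₁ (proj₂ neighbours)
    neighbour∈ : ∀ c → neighbour c ∈ Y × x ~ neighbour c
    neighbour∈ c = ∈-∩⁻ Y (E x) (proj₂ (proj₂ neighbours) c)
    rest : ∀ c → Matchings (k !) (X ─ x) (Y ─ neighbour c)
    rest c = IH k (≤-pred (subst (_≤ suc s) (card-─ X x∈X) X≤1+s))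
                  (≤-pred (subst (suc k ≤_) (card-─ X x∈X) k<X))
                  (hall-─ hall no-critical x∈X (neighbour c)) (degree-─ x (neighbour c) degree)
    M : Fin (suc k) → Fin (k !) → Matching X Y
    M c j = insert (proj₂ (neighbour∈ c)) (proj₁ (neighbour∈ c)) (proj₁ (rest c) j)
    mate-at-x : ∀ c j → mate (M c j) x ≡ neighbour c
    mate-at-x c j = piecewise-∈ ⁅ x ⁆ (λ _ → neighbour c) (mate (proj₁ (rest c) j)) (x∈⁅x⁆ x)
    mate-off-x : ∀ c j {z} → z ≢ x → mate (M c j) z ≡ mate (proj₁ (rest c) j) z
    mate-off-x c j z≢x = piecewise-∉ ⁅ x ⁆ (λ _ → neighbour c) (mate (proj₁ (rest c) j)) (z≢x ∘ ∈-⁅⁆⁻)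
    inner : ∀ c {j j′} → j ≢ j′ → Distinct (M c j) (M c j′)
    inner c {j} {j′} j≢j′ with proj₂ (rest c) j≢j′
    ... | z , z∈X─x , differ with ∈-─⁻ X z∈X─x
    ...   | z∈X , z≢x = z , z∈X , λ eq →
      differ (trans (sym (mate-off-x c j z≢x)) (trans eq (mate-off-x c j′ z≢x)))
    outer : ∀ {c c′} j j′ → c ≢ c′ → Distinct (M c j) (M c′ j′)
    outer {c} {c′} j j′ c≢c′ = x , x∈X , λ eq →
      c≢c′ (neighbour-inj (trans (sym (mate-at-x c j)) (trans eq (mate-at-x c′ j′))))

  neighbours⊆N : ∀ Y {A x} → x ∈ A → Y ∩ E x ⊆ N[ Y ] A
  neighbours⊆N Y {A} {x} x∈A y y∈ = uncurry (λ y∈Y x~y → ∈-N⁺ Y A y∈Y x∈A x~y) (∈-∩⁻ Y (E x) y∈)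

  N-restrict : ∀ Y {A B} → B ⊆ A → N[ Y ] B ⊆ N[ N[ Y ] A ] B
  N-restrict Y {A} {B} B⊆A y y∈N with ∈-N⁻ Y B y∈N
  ... | y∈Y , x , x∈B , x~y = ∈-N⁺ (N[ Y ] A) B (∈-N⁺ Y A y∈Y (B⊆A x x∈B) x~y) x∈B x~y

  hall-⊆ : ∀ {X Y A} → HallCondition X Y → A ⊆ X → HallCondition A (N[ Y ] A)
  hall-⊆ {X} {Y} {A} hall A⊆X B B⊆A =
    ≤-trans (hall B (λ x → A⊆X x ∘ B⊆A x)) (card-mono (N-restrict Y B⊆A))

  degree-⊆ : ∀ {k X Y A} → MinDegree k X Y → A ⊆ X → MinDegree k A (N[ Y ] A)
  degree-⊆ {k} {X} {Y} {A} degree A⊆X x x∈A = ≤-trans (degree x (A⊆X x x∈A)) (card-mono Y∩Ex⊆)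
    where
    Y∩Ex⊆ : Y ∩ E x ⊆ N[ Y ] A ∩ E x
    Y∩Ex⊆ y y∈ = ∈-∩⁺ (N[ Y ] A) (E x) (neighbours⊆N Y x∈A y y∈) (proj₂ (∈-∩⁻ Y (E x) y∈))

  N-∪ : ∀ Y A B → N[ Y ] (A ∪ B) ⊆ N[ Y ] A ∪ N[ Y ∖ N[ Y ] A ] B
  N-∪ Y A B y y∈N with ∈-N⁻ Y (A ∪ B) y∈N
  ... | y∈Y , x , x∈A∪B , x~y with ∈-∪⁻ A B x∈A∪B
  ...   | inj₁ x∈A = ∈-∪⁺ˡ (N[ Y ] A) (N[ Y ∖ N[ Y ] A ] B) (∈-N⁺ Y A y∈Y x∈A x~y)
  ...   | inj₂ x∈B = split (y ∈? N[ Y ] A)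
    where
    split : Dec (y ∈ N[ Y ] A) → y ∈ N[ Y ] A ∪ N[ Y ∖ N[ Y ] A ] B
    split (yes y∈NA) = ∈-∪⁺ˡ (N[ Y ] A) (N[ Y ∖ N[ Y ] A ] B) y∈NA
    split (no  y∉NA) = ∈-∪⁺ʳ (N[ Y ] A) (N[ Y ∖ N[ Y ] A ] B)
      (∈-N⁺ (Y ∖ N[ Y ] A) B (∈-∖⁺ Y (N[ Y ] A) y∈Y y∉NA) x∈B x~y)

  hall-∖ : ∀ {X Y A} → HallCondition X Y → A ⊆ X → card (N[ Y ] A) ≤ card A →
           HallCondition (X ∖ A) (Y ∖ N[ Y ] A)
  hall-∖ {X} {Y} {A} hall A⊆X tight B B⊆X∖A = +-cancelˡ-≤ (card A) (card B) _ (begin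
    card A + card B                                   ≡⟨ card-∪-disjoint A B disjoint ⟨
    card (A ∪ B)                                      ≤⟨ hall (A ∪ B) A∪B⊆X ⟩
    card (N[ Y ] (A ∪ B))                             ≤⟨ card-mono (N-∪ Y A B) ⟩
    card (N[ Y ] A ∪ N[ Y ∖ N[ Y ] A ] B)             ≤⟨ card-∪-≤ (N[ Y ] A) _ ⟩
    card (N[ Y ] A) + card (N[ Y ∖ N[ Y ] A ] B)      ≤⟨ +-monoˡ-≤ _ tight ⟩
    card A + card (N[ Y ∖ N[ Y ] A ] B)               ∎)
    where
    open ≤-Reasoning
    disjoint : ∀ x → x ∈ A → x ∉ B
    disjoint x x∈A x∈B = proj₂ (∈-∖⁻ X A (B⊆X∖A x x∈B)) x∈A
    A∪B⊆X : A ∪ B ⊆ X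
    A∪B⊆X x x∈A∪B with ∈-∪⁻ A B x∈A∪B
    ... | inj₁ x∈A = A⊆X x x∈A
    ... | inj₂ x∈B = proj₁ (∈-∖⁻ X A (B⊆X∖A x x∈B))

  join : ∀ {X Y} A → A ⊆ X → Matching A (N[ Y ] A) → Matching (X ∖ A) (Y ∖ N[ Y ] A) → Matching X Y
  join {X} {Y} A A⊆X M M′ = record
    { mate     = mate″
    ; mate-~   = λ {z} → mate″-~ (z ∈? A)
    ; mate-∈   = λ {z} → mate″-∈ (z ∈? A)
    ; mate-inj = λ {z} {z′} → mate″-inj (z ∈? A) (z′ ∈? A)
    }
    where
    mate″ = piecewise A (mate M) (mate M′)
    inside : ∀ {z} → z ∈ A → mate″ z ≡ mate M z
    inside = piecewise-∈ A (mate M) (mate M′)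
    outside : ∀ {z} → z ∉ A → mate″ z ≡ mate M′ z
    outside = piecewise-∉ A (mate M) (mate M′)
    ∈X∖A : ∀ {z} → z ∈ X → z ∉ A → z ∈ X ∖ A
    ∈X∖A = ∈-∖⁺ X A
    mate″-~ : ∀ {z} → Dec (z ∈ A) → z ∈ X → z ~ mate″ z
    mate″-~ (yes z∈A) _   = subst (_ ~_) (sym (inside z∈A)) (mate-~ M z∈A)
    mate″-~ (no  z∉A) z∈X = subst (_ ~_) (sym (outside z∉A)) (mate-~ M′ (∈X∖A z∈X z∉A))
    mate″-∈ : ∀ {z} → Dec (z ∈ A) → z ∈ X → mate″ z ∈ Y
    mate″-∈ (yes z∈A) _   = subst (_∈ Y) (sym (inside z∈A)) (proj₁ (∈-N⁻ Y A (mate-∈ M z∈A)))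
    mate″-∈ (no  z∉A) z∈X =
      subst (_∈ Y) (sym (outside z∉A)) (proj₁ (∈-∖⁻ Y (N[ Y ] A) (mate-∈ M′ (∈X∖A z∈X z∉A))))
    apart : ∀ {z z′} → z ∈ A → z′ ∈ X → z′ ∉ A → mate″ z ≢ mate″ z′
    apart {z} {z′} z∈A z′∈X z′∉A eq = proj₂ (∈-∖⁻ Y (N[ Y ] A) (mate-∈ M′ (∈X∖A z′∈X z′∉A)))
      (subst (_∈ N[ Y ] A) (trans (sym (inside z∈A)) (trans eq (outside z′∉A))) (mate-∈ M z∈A))
    mate″-inj : ∀ {z z′} → Dec (z ∈ A) → Dec (z′ ∈ A) → z ∈ X → z′ ∈ X →
                mate″ z ≡ mate″ z′ → z ≡ z′
    mate″-inj (yes z∈A) (yes z′∈A) _ _ eq =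
      mate-inj M z∈A z′∈A (trans (sym (inside z∈A)) (trans eq (inside z′∈A)))
    mate″-inj (yes z∈A) (no z′∉A) _ z′∈X eq = ⊥-elim (apart z∈A z′∈X z′∉A eq)
    mate″-inj (no z∉A) (yes z′∈A) z∈X _ eq = ⊥-elim (apart z′∈A z∈X z∉A (sym eq))
    mate″-inj (no z∉A) (no z′∉A) z∈X z′∈X eq = mate-inj M′ (∈X∖A z∈X z∉A) (∈X∖A z′∈X z′∉A)
      (trans (sym (outside z∉A)) (trans eq (outside z′∉A)))

  matchings-by-splitting : ∀ {s X Y} k → HallMatchings s → card X ≤ suc s →
                           HallCondition X Y → MinDegree k X Y → ∃ (Critical X Y) →
                           Matchings (k !) X Y
  matchings-by-splitting {s} {X} {Y} k IH X≤1+s hall degree (A , A⊆X , 0<A , A<X , tight) =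
    joined , distinct
    where
    a   = proj₁ (nonempty A 0<A)
    a∈A = proj₂ (nonempty A 0<A)
    k≤A : k ≤ card A
    k≤A = begin
      k               ≤⟨ degree a (A⊆X a a∈A) ⟩
      card (Y ∩ E a)  ≤⟨ card-mono (neighbours⊆N Y a∈A) ⟩
      card (N[ Y ] A) ≤⟨ tight ⟩
      card A          ∎
      where open ≤-Reasoning
    X∖A<X : card (X ∖ A) < card X
    X∖A<X = card-mono-< (λ x → proj₁ ∘ ∈-∖⁻ X A) a (λ a∈X∖A → proj₂ (∈-∖⁻ X A a∈X∖A) a∈A) (A⊆X a a∈A)
    inside : Matchings (k !) A (N[ Y ] A)
    inside = IH k (≤-pred (≤-trans A<X X≤1+s)) k≤A (hall-⊆ hall A⊆X) (degree-⊆ degree A⊆X)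
    outside : Matching (X ∖ A) (Y ∖ N[ Y ] A)
    outside = proj₁ (IH 0 (≤-pred (≤-trans X∖A<X X≤1+s)) z≤n (hall-∖ hall A⊆X tight) (λ _ _ → z≤n)) zero
    joined : Fin (k !) → Matching X Y
    joined i = join A A⊆X (proj₁ inside i) outside
    on-A : ∀ i {z} → z ∈ A → mate (joined i) z ≡ mate (proj₁ inside i) z
    on-A i = piecewise-∈ A (mate (proj₁ inside i)) (mate outside)
    distinct : ∀ {i j} → i ≢ j → Distinct (joined i) (joined j)
    distinct {i} {j} i≢j with proj₂ inside i≢j
    ... | z , z∈A , differ = z , A⊆X z z∈A , λ eq → differ (trans (sym (on-A i z∈A)) (trans eq (on-A j z∈A)))

  -- M. Hall (1948).  Induction on |X| ≤ s: split X along a critical set if there is one; otherwise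
  -- pick x ∈ X and, for each of k neighbours y of x, extend the (k − 1)! matchings of X ─ x into Y ─ y.
  hall-matchings : ∀ s → HallMatchings s
  hall-matchings zero {X} k X≤0 k≤X _ _ with n≤0⇒n≡0 (≤-trans k≤X X≤0)
  ... | refl = empty-matching (card≡0⇒∉ X (n≤0⇒n≡0 X≤0))
  hall-matchings (suc s) {X} {Y} k X≤1+s k≤X hall degree with critical? X Y
  ... | yes critical   = matchings-by-splitting k (hall-matchings s) X≤1+s hall degree critical
  ... | no no-critical = without-critical k k≤X degree
    where
    without-critical : ∀ k → k ≤ card X → MinDegree k X Y → Matchings (k !) X Y
    without-critical (suc k) k≤X degree =
      matchings-by-removal k (hall-matchings s) X≤1+s k≤X hall degree no-critical
    without-critical zero _ _ with card X ≟ 0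
    ... | yes X≡0 = empty-matching (card≡0⇒∉ X X≡0)
    ... | no  X≢0 =
      matchings-by-removal 0 (hall-matchings s) X≤1+s (n≢0⇒n>0 X≢0) hall (hall⇒degree≥1 hall) no-critical

  -- Double counting of the edges leaving A.
  biregular⇒hall : ∀ {d} → 0 < d → (∀ x → d ≤ card (E x)) → (∀ y → card (λ x → E x y) ≤ d) →
                   HallCondition full full
  biregular⇒hall {d} 0<d left right A _ = *-cancelʳ-≤ (card A) (card (N[ full ] A)) d {{>-nonZero 0<d}} (begin
    card A * d                                 ≡⟨ *-distribʳ-sum d (χ ∘ A) ⟩
    sum (λ x → χ (A x) * d)                    ≤⟨ sum-mono-≤ from-left ⟩
    sum (λ x → sum (λ y → χ (A x ∧ E x y)))    ≡⟨ ∑-comm (λ x y → χ (A x ∧ E x y)) ⟩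
    sum (λ y → sum (λ x → χ (A x ∧ E x y)))    ≤⟨ sum-mono-≤ (λ y → to-right y (y ∈? N[ full ] A)) ⟩
    sum (λ y → χ ((N[ full ] A) y) * d)        ≡⟨ *-distribʳ-sum d (χ ∘ N[ full ] A) ⟨
    card (N[ full ] A) * d                     ∎)
    where
    open ≤-Reasoning
    from-left : ∀ x → χ (A x) * d ≤ sum (λ y → χ (A x ∧ E x y))
    from-left x with A x
    ... | true  = ≤-trans (≤-reflexive (+-identityʳ d)) (left x)
    ... | false = z≤n
    to-right : ∀ y → Dec (y ∈ N[ full ] A) → sum (λ x → χ (A x ∧ E x y)) ≤ χ ((N[ full ] A) y) * d
    to-right y (yes y∈N) rewrite y∈N = begin
      sum (λ x → χ (A x ∧ E x y)) ≤⟨ sum-mono-≤ (λ x → χ-mono (Bool.∧-conicalʳ (A x) (E x y))) ⟩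
      card (λ x → E x y)          ≤⟨ right y ⟩
      d                           ≡⟨ +-identityʳ d ⟨
      1 * d                       ∎
    to-right y (no y∉N) rewrite Bool.¬-not y∉N =
      ≤-reflexive (trans (sum-cong-≗ (cong χ ∘ no-edge)) (sum-replicate-zero n))
      where
      no-edge : ∀ x → A x ∧ E x y ≡ false
      no-edge x = Bool.¬-not λ x∈A∧x~y → y∉N (uncurry (∈-N⁺ full A refl) (∈-∩⁻ A (λ x → E x y) x∈A∧x~y))

-- Latin rectangles

record LatinRectangle (r n : ℕ) : Set where
  field
    entry            : Fin r → Fin n → Fin n
    row-injective    : ∀ i → Injective _≡_ _≡_ (entry i)
    column-injective : ∀ j → Injective _≡_ _≡_ (λ i → entry i j)

  column : Fin n → Fin r → Fin n
  column j i = entry i j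

open LatinRectangle public

LatinSquare : ℕ → Set
LatinSquare n = LatinRectangle n n

_≉_ : ∀ {r n} → LatinRectangle r n → LatinRectangle r n → Set
L ≉ L′ = ∃₂ λ i j → entry L i j ≢ entry L′ i j

module Extension {r n} (L : LatinRectangle r n) (r<n : r < n) where

  used free : Fin n → FinSet n
  used j = image (column L j)
  free j = ∁ (used j)

  open BipartiteGraph free

  column-degree : ∀ j → card (free j) ≡ n ∸ r
  column-degree j = begin
    card (free j)                                  ≡⟨ m+n∸n≡m (card (free j)) (card (used j)) ⟨
    card (free j) + card (used j) ∸ card (used j)  ≡⟨ cong₂ _∸_ (card-∁ (used j)) (card-image (column L j) (column-injective L j)) ⟩
    n ∸ r                                          ∎
    where open ≡-Reasoning

  symbol-degree : ∀ s → card (λ j → free j s) ≤ n ∸ r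
  symbol-degree s = m+n≤o⇒m≤o∸n _ (begin
    card (∁ hosts) + r                     ≡⟨ cong (card (∁ hosts) +_) (card-image position position-injective) ⟨
    card (∁ hosts) + card (image position) ≤⟨ +-monoʳ-≤ (card (∁ hosts)) (card-mono position-hosts) ⟩
    card (∁ hosts) + card hosts            ≡⟨ card-∁ hosts ⟩
    n                                      ∎)
    where
    open ≤-Reasoning
    hosts : FinSet n
    hosts j = used j s
    position : Fin r → Fin n
    position i = proj₁ (injective⇒surjective (entry L i) (row-injective L i) s)
    entry-position : ∀ i → entry L i (position i) ≡ s
    entry-position i = proj₂ (injective⇒surjective (entry L i) (row-injective L i) s)
    position-injective : Injective _≡_ _≡_ position
    position-injective {i} {i′} eq = column-injective L (position i′)
      (trans (cong (entry L i) (sym eq)) (trans (entry-position i) (sym (entry-position i′))))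
    position-hosts : image position ⊆ hosts
    position-hosts j j∈image with ∈-image⁻ position j∈image
    ... | i , refl = subst (_∈ used (position i)) (entry-position i) (∈-image⁺ (column L (position i)) i)

  extensions : Matchings ((n ∸ r) !) full full
  extensions = hall-matchings n (n ∸ r) (card≤n full) (subst (n ∸ r ≤_) (sym card-full) (m∸n≤m n r))
    (biregular⇒hall (m<n⇒0<n∸m r<n) (≤-reflexive ∘ sym ∘ column-degree) symbol-degree)
    (λ j _ → ≤-reflexive (sym (column-degree j)))

  extend : Matching full full → LatinRectangle (suc r) n
  extend M = record { entry = entry′ ; row-injective = row-injective′ ; column-injective = column-injective′ }
    where
    entry′ : Fin (suc r) → Fin n → Fin n
    entry′ zero    = mate M
    entry′ (suc i) = entry L i
    row-injective′ : ∀ i → Injective _≡_ _≡_ (entry′ i)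
    row-injective′ zero    = mate-inj M refl refl
    row-injective′ (suc i) = row-injective L i
    new : ∀ {j} i → mate M j ≢ entry L i j
    new {j} i eq = ∈-∁⁻ (used j) (mate-~ M refl) (subst (_∈ used j) (sym eq) (∈-image⁺ (column L j) i))
    column-injective′ : ∀ j → Injective _≡_ _≡_ (λ i → entry′ i j)
    column-injective′ j {zero}  {zero}  _  = refl
    column-injective′ j {zero}  {suc i} eq = ⊥-elim (new i eq)
    column-injective′ j {suc i} {zero}  eq = ⊥-elim (new i (sym eq))
    column-injective′ j {suc i} {suc i′} eq = cong suc (column-injective L j eq)

rectangles : ℕ → ℕ → ℕ
rectangles n zero    = 1
rectangles n (suc r) = rectangles n r * (n ∸ r) !

latinRectangles : ∀ n r → r ≤ n → ApartFamily _≉_ (rectangles n r)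
latinRectangles n zero _ = (λ _ → empty) , λ { {zero} {zero} 0≢0 → ⊥-elim (0≢0 refl) }
  where
  empty : LatinRectangle 0 n
  empty = record { entry = λ () ; row-injective = λ () ; column-injective = λ { _ {()} } }
latinRectangles n (suc r) r<n = apartFamily-* _≉_ extended new-rows-differ old-rows-differ
  where
  previous = latinRectangles n r (<⇒≤ r<n)
  extended : Fin (rectangles n r) → Fin ((n ∸ r) !) → LatinRectangle (suc r) n
  extended k l = Extension.extend (proj₁ previous k) r<n (proj₁ (Extension.extensions (proj₁ previous k) r<n) l)
  new-rows-differ : ∀ k {l l′} → l ≢ l′ → extended k l ≉ extended k l′
  new-rows-differ k l≢l′ with proj₂ (Extension.extensions (proj₁ previous k) r<n) l≢l′
  ... | j , _ , differ = zero , j , differ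
  old-rows-differ : ∀ {k k′} l l′ → k ≢ k′ → extended k l ≉ extended k′ l′
  old-rows-differ l l′ k≢k′ with proj₂ previous k≢k′
  ... | i , j , differ = suc i , j , differ

latinSquares : ∀ n → ApartFamily _≉_ (rectangles n n)
latinSquares n = latinRectangles n n ≤-refl

-- Counting

largest : (P : ℕ → Set) → Decidable P → P 0 → ∀ B → (∀ r → P r → r ≤ B) →
          Σ ℕ λ R → P R × (∀ r → P r → r ≤ R)
largest P P? P0 zero    bounded = 0 , P0 , bounded
largest P P? P0 (suc B) bounded with P? (suc B)
... | yes PB = suc B , PB , bounded
... | no ¬PB = largest P P? P0 B λ r Pr → ≤-pred (≤∧≢⇒< (bounded r Pr) λ { refl → ¬PB Pr })

n<2^n : ∀ n → n < 2 ^ n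
n<2^n zero    = s≤s z≤n
n<2^n (suc n) = +-mono-≤ (m^n>0 2 n) (≤-trans (n<2^n n) (≤-reflexive (sym (+-identityʳ (2 ^ n)))))

^≤! : ∀ m k {N} → k + m ≤ N → m ^ k ≤ N !
^≤! m zero    {N}     _       = 1≤n! N
^≤! m (suc k) {suc N} k+m<1+N = *-mono-≤ (≤-trans (m≤n+m m (suc k)) k+m<1+N) (^≤! m k (≤-pred k+m<1+N))

rectangles-mono : ∀ n {r s} → r ≤ s → rectangles n r ≤ rectangles n s
rectangles-mono n = grow ∘′ ≤⇒≤′
  where
  grow : ∀ {r s} → r ≤′ s → rectangles n r ≤ rectangles n s
  grow ≤′-refl           = ≤-refl
  grow (≤′-step {s} r≤s) = ≤-trans (grow r≤s)
    (≤-trans (≤-reflexive (sym (*-identityʳ (rectangles n s)))) (*-monoʳ-≤ (rectangles n s) (1≤n! (n ∸ s))))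

rectangles-lower : ∀ n m → 4 * m ≤ n → ∀ r → r ≤ m → (m ^ (2 * m)) ^ r ≤ rectangles n r
rectangles-lower n m 4m≤n zero    _   = ≤-refl
rectangles-lower n m 4m≤n (suc r) r<m = begin
  m ^ (2 * m) * (m ^ (2 * m)) ^ r          ≡⟨ *-comm (m ^ (2 * m)) _ ⟩
  (m ^ (2 * m)) ^ r * m ^ (2 * m)          ≤⟨ *-mono-≤ (rectangles-lower n m 4m≤n r (<⇒≤ r<m)) (^≤! m (2 * m) room) ⟩
  rectangles n r * (n ∸ r) !               ∎
  where
  open ≤-Reasoning
  room : 2 * m + m ≤ n ∸ r
  room = m+n≤o⇒m≤o∸n (2 * m + m) (begin
    2 * m + m + r ≤⟨ +-monoʳ-≤ (2 * m + m) (<⇒≤ r<m) ⟩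
    2 * m + m + m ≡⟨ 2m+m+m≡4m m ⟩
    4 * m         ≤⟨ 4m≤n ⟩
    n             ∎)
    where
    2m+m+m≡4m : ∀ m → 2 * m + m + m ≡ 4 * m
    2m+m+m≡4m = solve-∀

-- With m = ⌊n/4⌋ we have n ≤ 5m ≤ m², and each of the first m factors of rectangles n n is at least
-- (3m)! ≥ m^(2m).
rectangles-lower-square : ∀ n → 20 ≤ n → n ^ (3 * (n * n)) ≤ rectangles n n ^ 75
rectangles-lower-square n 20≤n = begin
  n ^ (3 * (n * n))                   ≤⟨ ^-monoˡ-≤ (3 * (n * n)) n≤m*m ⟩
  (m * m) ^ (3 * (n * n))             ≤⟨ ^-monoʳ-≤ (m * m) {{m*m≢0}} (*-monoʳ-≤ 3 (*-mono-≤ n≤5m n≤5m)) ⟩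
  (m * m) ^ (3 * (5 * m * (5 * m)))   ≡⟨ cong (λ k → (m * k) ^ (3 * (5 * m * (5 * m)))) (*-identityʳ m) ⟨
  (m ^ 2) ^ (3 * (5 * m * (5 * m)))   ≡⟨ ^-*-assoc m 2 (3 * (5 * m * (5 * m))) ⟩
  m ^ (2 * (3 * (5 * m * (5 * m))))   ≡⟨ cong (m ^_) (exponents m) ⟩
  m ^ (2 * m * m * 75)                ≡⟨ ^-*-assoc m (2 * m * m) 75 ⟨
  (m ^ (2 * m * m)) ^ 75              ≡⟨ cong (_^ 75) (^-*-assoc m (2 * m) m) ⟨
  ((m ^ (2 * m)) ^ m) ^ 75            ≤⟨ ^-monoˡ-≤ 75 (rectangles-lower n m 4m≤n m ≤-refl) ⟩
  rectangles n m ^ 75                 ≤⟨ ^-monoˡ-≤ 75 (rectangles-mono n (≤-trans (m≤n*m m 4) 4m≤n)) ⟩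
  rectangles n n ^ 75                 ∎
  where
  open ≤-Reasoning
  m = n / 4
  5≤m : 5 ≤ m
  5≤m = /-monoˡ-≤ 4 20≤n
  4m≤n : 4 * m ≤ n
  4m≤n = ≤-trans (≤-reflexive (*-comm 4 m)) (m/n*n≤m n 4)
  n≤5m : n ≤ 5 * m
  n≤5m = begin
    n             ≡⟨ m≡m%n+[m/n]*n n 4 ⟩
    n % 4 + m * 4 ≤⟨ +-mono-≤ (≤-trans (<⇒≤ (m%n<n n 4)) (≤-trans (n≤1+n 4) 5≤m))
                              (≤-reflexive (*-comm m 4)) ⟩
    5 * m         ∎
  n≤m*m : n ≤ m * m
  n≤m*m = ≤-trans n≤5m (*-monoˡ-≤ m 5≤m)
  instance
    m*m≢0 : NonZero (m * m)
    m*m≢0 = >-nonZero (*-mono-< (≤-trans (s≤s z≤n) 5≤m) (≤-trans (s≤s z≤n) 5≤m))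
  exponents : ∀ m → 2 * (3 * (5 * m * (5 * m))) ≡ 2 * m * m * 75
  exponents = solve-∀

enough-latinSquares : ∀ q n R → 20 ≤ n → q ^ (75 * R) < n ^ n →
                      q ^ (R * n) * (q ^ (R * n) * q ^ (R * n)) < rectangles n n
enough-latinSquares q n R 20≤n small = ≰⇒> λ P≤M → <⇒≱ M^75<P^75 (^-monoˡ-≤ 75 P≤M)
  where
  open ≤-Reasoning
  Q = q ^ (R * n)
  instance
    3n≢0 : NonZero (3 * n)
    3n≢0 = >-nonZero (*-monoʳ-< 3 (≤-trans (s≤s z≤n) 20≤n))
  exponents : ∀ R n → R * n * (3 * 75) ≡ 75 * R * (3 * n)
  exponents = solve-∀
  M^75<P^75 : (Q * (Q * Q)) ^ 75 < rectangles n n ^ 75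
  M^75<P^75 = begin-strict
    (Q * (Q * Q)) ^ 75         ≡⟨ cong (λ k → (Q * (Q * k)) ^ 75) (*-identityʳ Q) ⟨
    (Q ^ 3) ^ 75               ≡⟨ ^-*-assoc Q 3 75 ⟩
    Q ^ (3 * 75)               ≡⟨ ^-*-assoc q (R * n) (3 * 75) ⟩
    q ^ (R * n * (3 * 75))     ≡⟨ cong (q ^_) (exponents R n) ⟩
    q ^ (75 * R * (3 * n))     ≡⟨ ^-*-assoc q (75 * R) (3 * n) ⟨
    (q ^ (75 * R)) ^ (3 * n)   <⟨ ^-monoˡ-< (3 * n) small ⟩
    (n ^ n) ^ (3 * n)          ≡⟨ ^-*-assoc n n (3 * n) ⟩
    n ^ (n * (3 * n))          ≡⟨ cong (n ^_) (*-comm n (3 * n)) ⟩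
    n ^ (3 * n * n)            ≡⟨ cong (n ^_) (*-assoc 3 n n) ⟩
    n ^ (3 * (n * n))          ≤⟨ rectangles-lower-square n 20≤n ⟩
    rectangles n n ^ 75        ∎

-- Permutation tensors of large rank

module _ {c ℓ : Level} (F : FiniteField c ℓ) where

  module 𝔽 = FiniteField F
  open 𝔽 using (Carrier; _≈_; 0#; 1#; 1≉0; size; enum)
    renaming (_*_ to _·_; refl to ≈-refl; sym to ≈-sym; trans to ≈-trans)

  indicator : Bool → Carrier
  indicator true  = 1#
  indicator false = 0#

  indicator≈1 : ∀ {b} → indicator b ≈ 1# → b ≡ true
  indicator≈1 {true}  _   = refl
  indicator≈1 {false} 0≈1 = ⊥-elim (1≉0 (≈-sym 0≈1))

  latinTensor : ∀ {n} → LatinSquare n → Tensor3 F n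
  latinTensor L i j = indicator ∘ ⁅ entry L i j ⁆

  latinTensor≈1 : ∀ {n} (L : LatinSquare n) {i j k} → latinTensor L i j k ≈ 1# → k ≡ entry L i j
  latinTensor≈1 L = ∈-⁅⁆⁻ ∘ indicator≈1

  latinTensor≡⇒≈1 : ∀ {n} (L : LatinSquare n) {i j k} → entry L i j ≡ k → latinTensor L i j k ≈ 1#
  latinTensor≡⇒≈1 L {i} {j} refl = subst (λ b → indicator b ≈ 1#) (sym (x∈⁅x⁆ (entry L i j))) ≈-refl

  latinTensor-isPermutation : ∀ {n} (L : LatinSquare n) → IsPermutationTensor F (latinTensor L)
  latinTensor-isPermutation L = zero-or-one , fixing-j-k , fixing-i-k , fixing-i-j
    where
    zero-or-one : ∀ i j k → (latinTensor L i j k ≈ 0#) ⊎ (latinTensor L i j k ≈ 1#)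
    zero-or-one i j k with ⁅ entry L i j ⁆ k
    ... | true  = inj₂ ≈-refl
    ... | false = inj₁ ≈-refl
    fixing-j-k : ∀ j k → Σ _ λ i → (latinTensor L i j k ≈ 1#) × (∀ i′ → latinTensor L i′ j k ≈ 1# → i′ ≡ i)
    fixing-j-k j k with injective⇒surjective (column L j) (column-injective L j) k
    ... | i , entry≡k = i , latinTensor≡⇒≈1 L entry≡k ,
                        λ i′ one → column-injective L j (trans (sym (latinTensor≈1 L one)) (sym entry≡k))
    fixing-i-k : ∀ i k → Σ _ λ j → (latinTensor L i j k ≈ 1#) × (∀ j′ → latinTensor L i j′ k ≈ 1# → j′ ≡ j)
    fixing-i-k i k with injective⇒surjective (entry L i) (row-injective L i) k
    ... | j , entry≡k = j , latinTensor≡⇒≈1 L entry≡k ,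
                        λ j′ one → row-injective L i (trans (sym (latinTensor≈1 L one)) (sym entry≡k))
    fixing-i-j : ∀ i j → Σ _ λ k → (latinTensor L i j k ≈ 1#) × (∀ k′ → latinTensor L i j k′ ≈ 1# → k′ ≡ k)
    fixing-i-j i j = entry L i j , latinTensor≡⇒≈1 L refl , λ _ → latinTensor≈1 L

  sumFin-cong : ∀ r {f g : Fin r → Carrier} → (∀ t → f t ≈ g t) → sumFin F r f ≈ sumFin F r g
  sumFin-cong zero    f≈g = ≈-refl
  sumFin-cong (suc r) f≈g = 𝔽.+-cong (f≈g zero) (sumFin-cong r (f≈g ∘ suc))

  rankDecomposition-suc : ∀ {n} {T : Tensor3 F n} {r} →
                          HasRankDecomposition F T r → HasRankDecomposition F T (suc r)
  rankDecomposition-suc {T = T} {r} (u , v , w , T≈) = extend u , extend v , extend w ,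
    λ i j k → ≈-trans (T≈ i j k) (≈-sym (≈-trans (𝔽.+-congʳ (zero-term _ _)) (𝔽.+-identityˡ _)))
    where
    zero-term : ∀ a b → 0# · a · b ≈ 0#
    zero-term a b = ≈-trans (𝔽.*-congʳ (𝔽.zeroˡ a)) (𝔽.zeroˡ b)
    extend : ∀ {n} → (Fin r → Fin n → Carrier) → Fin (suc r) → Fin n → Carrier
    extend u zero    = λ _ → 0#
    extend u (suc t) = u t

  rankDecomposition-mono : ∀ {n} {T : Tensor3 F n} {r R} → r ≤ R →
                           HasRankDecomposition F T r → HasRankDecomposition F T R
  rankDecomposition-mono = pad ∘ ≤⇒≤′
    where
    pad : ∀ {n} {T : Tensor3 F n} {r R} → r ≤′ R → HasRankDecomposition F T r → HasRankDecomposition F T R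
    pad ≤′-refl        = λ d → d
    pad (≤′-step r≤′R) = rankDecomposition-suc ∘ pad r≤′R

  private
    code : Carrier → Fin size
    code = Inverse.to enum

    decode : Fin size → Carrier
    decode = Inverse.from enum

    decode-code : ∀ x → decode (code x) ≈ x
    decode-code = Inverse.strictlyInverseʳ enum

    code-injective : ∀ {x y} → code x ≡ code y → x ≈ y
    code-injective = Injection.injective (Inverse⇒Injection enum)

  2≤size : 2 ≤ size
  2≤size = two-elements (code 1#) (code 0#) (1≉0 ∘ code-injective)
    where
    two-elements : ∀ {k} (x y : Fin k) → x ≢ y → 2 ≤ k
    two-elements {suc zero}    zero zero x≢y = ⊥-elim (x≢y refl)
    two-elements {suc (suc k)} _    _    _   = s≤s (s≤s z≤n)

  -- Through enum, a factor matrix Fin R → Fin n → F is coded by an element of Fin (size ^ (R * n)), and a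
  -- rank-R decomposition by an element of Fin (Q * (Q * Q)).
  module Enumeration (n R : ℕ) where

    Q : ℕ
    Q = size ^ (R * n)

    factor : Fin Q → Fin R → Fin n → Carrier
    factor a t i = decode (finToFun a (combine t i))

    factor-complete : (u : Fin R → Fin n → Carrier) → ∃ λ a → ∀ t i → factor a t i ≈ u t i
    factor-complete u = funToFin (code ∘ uncurry u ∘ remQuot n) , λ t i →
      subst (λ x → decode x ≈ u t i)
        (sym (trans (Fin.finToFun-funToFin (code ∘ uncurry u ∘ remQuot n) (combine t i))
                    (cong (code ∘ uncurry u) (Fin.remQuot-combine t i))))
        (decode-code (u t i))

    decomposition : Fin Q → Fin Q → Fin Q → Tensor3 F n
    decomposition a b c i j k = sumFin F R (λ t → factor a t i · factor b t j · factor c t k)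

    enumeratedTensor : Fin (Q * (Q * Q)) → Tensor3 F n
    enumeratedTensor x = uncurry (λ a → uncurry (decomposition a) ∘ remQuot Q) (remQuot (Q * Q) x)

    enumeratedTensor-complete : ∀ {T} → HasRankDecomposition F T R →
                                ∃ λ x → ∀ i j k → enumeratedTensor x i j k ≈ T i j k
    enumeratedTensor-complete {T} (u , v , w , T≈)
      with factor-complete u | factor-complete v | factor-complete w
    ... | a , a≈u | b , b≈v | c , c≈w = combine a (combine b c) , λ i j k →
      subst (λ S → S i j k ≈ T i j k) (sym (enumeratedTensor-combine a b c))
        (≈-trans (sumFin-cong R (λ t → 𝔽.*-cong (𝔽.*-cong (a≈u t i) (b≈v t j)) (c≈w t k))) (≈-sym (T≈ i j k)))
      where
      enumeratedTensor-combine : ∀ a b c → enumeratedTensor (combine a (combine b c)) ≡ decomposition a b c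
      enumeratedTensor-combine a b c =
        trans (cong (uncurry (λ a → uncurry (decomposition a) ∘ remQuot Q)) (Fin.remQuot-combine a (combine b c)))
              (cong (uncurry (decomposition a)) (Fin.remQuot-combine b c))

    private
      names : Fin (Q * (Q * Q)) → LatinSquare n → Set
      names x L = ∀ i j k → code (enumeratedTensor x i j k) ≡ code (latinTensor L i j k)
      names? : ∀ x s → Dec (names x (proj₁ (latinSquares n) s))
      names? x s = Fin.all? λ i → Fin.all? λ j → Fin.all? λ k →
        code (enumeratedTensor x i j k) Fin.≟ code (latinTensor (proj₁ (latinSquares n) s) i j k)
      unique : ∀ x L L′ → names x L → names x L′ → ¬ L ≉ L′
      unique x L L′ x-names-L x-names-L′ (i , j , differ) = differ (latinTensor≈1 L′ L′ijk≈1)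
        where
        k = entry L i j
        L′ijk≈1 : latinTensor L′ i j k ≈ 1#
        L′ijk≈1 = ≈-trans (code-injective (trans (sym (x-names-L′ i j k)) (x-names-L i j k))) (latinTensor≡⇒≈1 L refl)

    hard-latinSquare : Q * (Q * Q) < rectangles n n →
                       Σ (LatinSquare n) λ L → ¬ HasRankDecomposition F (latinTensor L) R
    hard-latinSquare fewer with apartFamily-unnamed _≉_ (latinSquares n) names names? unique fewer
    ... | s , unnamed = proj₁ (latinSquares n) s , λ decomposition →
      let x , x≈L = enumeratedTensor-complete decomposition in unnamed x (λ i j k → Inverse.to-cong enum (x≈L i j k))

  rank-threshold : ∀ n → 20 ≤ n →
                   Σ ℕ λ R → size ^ (75 * R) < n ^ n × (∀ r → size ^ (75 * r) < n ^ n → r ≤ R)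
  rank-threshold n 20≤n = largest (λ r → size ^ (75 * r) < n ^ n) (λ r → size ^ (75 * r) <? n ^ n) 1<n^n (n ^ n) bounded
    where
    instance
      size≢0 : NonZero size
      size≢0 = >-nonZero (≤-trans (s≤s z≤n) 2≤size)
    1<n : 1 < n
    1<n = ≤-trans (s≤s (s≤s z≤n)) 20≤n
    1<n^n : size ^ (75 * 0) < n ^ n
    1<n^n = ^-monoʳ-< n 1<n (<-trans (s≤s z≤n) 1<n)
    bounded : ∀ r → size ^ (75 * r) < n ^ n → r ≤ n ^ n
    bounded r small = <⇒≤ (begin-strict
      r               <⟨ n<2^n r ⟩
      2 ^ r           ≤⟨ ^-monoˡ-≤ r 2≤size ⟩
      size ^ r        ≤⟨ ^-monoʳ-≤ size (m≤n*m r 75) ⟩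
      size ^ (75 * r) <⟨ small ⟩
      n ^ n           ∎)
      where open ≤-Reasoning

  permutationTensor-rank-bound : ∀ {n R} → (∀ r → size ^ (75 * r) < n ^ n → r ≤ R) →
      Σ (LatinSquare n) (λ L → ¬ HasRankDecomposition F (latinTensor L) R) →
      Σ (Tensor3 F n) λ T → IsPermutationTensor F T ×
        (∀ r → HasRankDecomposition F T r → size ^ (75 * r) ≥ n ^ (1 * n))
  permutationTensor-rank-bound {n} R-largest (L , ¬rank-R) = latinTensor L , latinTensor-isPermutation L , rank≥
    where
    rank≥ : ∀ r → HasRankDecomposition F (latinTensor L) r → size ^ (75 * r) ≥ n ^ (1 * n)
    rank≥ r rank-r with n ^ n ≤? size ^ (75 * r)
    ... | yes large = subst (λ k → n ^ k ≤ size ^ (75 * r)) (sym (*-identityˡ n)) large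
    ... | no ¬large = ⊥-elim (¬rank-R (rankDecomposition-mono (R-largest r (≰⇒> ¬large)) rank-r))

  rank-lower-bound : ∀ n → 20 ≤ n → Σ (Tensor3 F n) λ T → IsPermutationTensor F T ×
                     (∀ r → HasRankDecomposition F T r → size ^ (75 * r) ≥ n ^ (1 * n))
  rank-lower-bound n 20≤n with rank-threshold n 20≤n
  ... | R , small-R , R-largest = permutationTensor-rank-bound R-largest
    (Enumeration.hard-latinSquare n R (enough-latinSquares size n R 20≤n small-R))

proposition6p2 : ∀ {c ℓ : Level} (F : FiniteField c ℓ) →
    Σ ℕ λ a → Σ ℕ λ b → (1 ≤ a) × (1 ≤ b) × (Σ ℕ λ N → ∀ n → n ≥ N →
      Σ (Tensor3 F n) λ T → IsPermutationTensor F T ×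
        (∀ r → HasRankDecomposition F T r →
          FiniteField.size F ^ (b * r) ≥ n ^ (a * n)))
proposition6p2 F = 1 , 75 , s≤s z≤n , s≤s z≤n , 20 , rank-lower-bound F
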